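{- Let $G=(V,E)$ be a connected graph with at least two vertices, $\mu$ a nice $k$-expression of $G$, and $t=G_{t_1}\oplus G_{t_2}$ a union node of the augmented syntax tree $\hat T_\mu$. Then $L^{\mathrm{live}}_{t_1}\cap L^{\mathrm{dead}}_{t_2}=\emptyset=L^{\mathrm{dead}}_{t_1}\cap L^{\mathrm{live}}_{t_2}$, and the sets $L^{\mathrm{live}}_{t_1}\setminus L_{t_2}$, $L^{\mathrm{live}}_{t_2}\setminus L_{t_1}$, and $L^{\mathrm{live}}_{t_1}\cap L^{\mathrm{live}}_{t_2}$ partition $L^{\mathrm{live}}_t$.
   Context: Clique-expressions use operations introduce $\ell(v)$, disjoint union $\oplus$, relabel $\rho_{i\to j}$, join $\eta_{i,j}$ ($i\ne j$, adds all edges between label-$i$ and label-$j$ vertices); a $k$-expression uses labels $1,\dots,k$ only. For a node $t$, $G_t=(V_t,E_t)$ is the graph built at $t$, $V_t^\ell$ its vertices with label $\ell$, $L_t=\{\ell:V_t^\ell\neq\emptyset\}$, and $D_t=\{v\in V_t:\text{all edges of }G\text{ incident to }v\text{ lie in }E_t\}$. Irredundant: at each join node $\eta_{i,j}(G_{t'})$ there is no edge of $G_{t'}$ between $V_{t'}^i$ and $V_{t'}^j$. Nice: irredundant, every join node $\eta_{i,j}(G_{t'})$ adds at least one edge and has $V_{t'}^i,V_{t'}^j\ne\emptyset$, and every relabel node $\rho_{i\to j}(G_{t'})$ has $V_{t'}^i,V_{t'}^j\neq\emptyset$. The augmented syntax tree $\hat T_\mu$ is obtained by inserting, directly above each join node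 $t=\eta_{i,j}(G_{t'})$, a dead node $\mathrm{dead}_i$ if $V_t^i\subseteq D_t\setminus D_{t'}$ and a dead node $\mathrm{dead}_j$ if $V_t^j\subseteq D_t\setminus D_{t'}$ (any order); dead nodes inherit $G_t,V_t,D_t,V_t^\ell$ from their child. Live labels: $L^{\mathrm{live}}_t=\{\ell\}$ for $t=\ell(v)$; $L^{\mathrm{live}}_{t'}\setminus\{i\}$ for $t=\rho_{i\to j}(G_{t'})$; $L^{\mathrm{live}}_{t'}$ for $t=\eta_{i,j}(G_{t'})$; $L^{\mathrm{live}}_{t'}\setminus\{\ell\}$ for $t=\mathrm{dead}_\ell(G_{t'})$; $L^{\mathrm{live}}_{t_1}\cup L^{\mathrm{live}}_{t_2}$ for $t=G_{t_1}\oplus G_{t_2}$. Dead labels: $L^{\mathrm{dead}}_t=L_t\setminus L^{\mathrm{live}}_t$. -}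

module Defs where

open import Data.Nat using (ℕ)
open import Data.Fin using (Fin)
open import Data.Empty using (⊥)
open import Data.Unit using (⊤)
open import Data.Product using (Σ; ∃; ∃-syntax; _×_; _,_)
open import Data.Sum using (_⊎_)
open import Relation.Nullary using (¬_)
open import Relation.Binary.PropositionalEquality using (_≡_; _≢_)
open import Relation.Binary.Construct.Closure.ReflexiveTransitive using (Star)

record Graph (n : ℕ) : Set₁ where
  field
    Adj     : Fin n → Fin n → Set
    symm    : ∀ {u v} → Adj u v → Adj v u
    irrefl  : ∀ {u} → ¬ Adj u u

open Graph public

Connected : ∀ {n} → Graph n → Set
Connected G = ∀ u v → Star (Adj G) u v

-- Clique-expressions over vertices Fin n with labels Fin k.
--   intro v ℓ  is  ℓ(v)
--   a ⊕ b      is  disjoint union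
--   ρ i j t    is  ρ_{i→j}(t)
--   η i j t    is  η_{i,j}(t)

data Expr (n k : ℕ) : Set where
  intro : Fin n → Fin k → Expr n k
  _⊕_   : Expr n k → Expr n k → Expr n k
  ρ     : Fin k → Fin k → Expr n k → Expr n k
  η     : Fin k → Fin k → Expr n k → Expr n k

module _ {n k : ℕ} where

  Lab : Expr n k → Fin n → Fin k → Set
  Lab (intro v ℓ) u m = u ≡ v × m ≡ ℓ
  Lab (a ⊕ b)     u m = Lab a u m ⊎ Lab b u m
  Lab (ρ i j t)   u m = (Lab t u m × m ≢ i) ⊎ (Lab t u i × m ≡ j)
  Lab (η i j t)   u m = Lab t u m

  InV : Expr n k → Fin n → Set
  InV t v = ∃[ m ] Lab t v m

  Labels : Expr n k → Fin k → Set
  Labels t ℓ = ∃[ v ] Lab t v ℓ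

  Edge : Expr n k → Fin n → Fin n → Set
  Edge (intro _ _) u v = ⊥
  Edge (a ⊕ b)     u v = Edge a u v ⊎ Edge b u v
  Edge (ρ _ _ t)   u v = Edge t u v
  Edge (η i j t)   u v = Edge t u v ⊎ ((Lab t u i × Lab t v j) ⊎ (Lab t u j × Lab t v i))

  data _≼_ : Expr n k → Expr n k → Set where
    here  : ∀ {t} → t ≼ t
    left  : ∀ {s a b} → s ≼ a → s ≼ (a ⊕ b)
    right : ∀ {s a b} → s ≼ b → s ≼ (a ⊕ b)
    underρ : ∀ {s i j t} → s ≼ t → s ≼ ρ i j t
    underη : ∀ {s i j t} → s ≼ t → s ≼ η i j t

  WF : Expr n k → Set
  WF (intro _ _) = ⊤
  WF (a ⊕ b)     = WF a × WF b × (∀ v → InV a v → ¬ InV b v)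
  WF (ρ i j t)   = i ≢ j × WF t
  WF (η i j t)   = i ≢ j × WF t

  IsKExpr : Graph n → Expr n k → Set
  IsKExpr G μ = WF μ × (∀ v → InV μ v)
              × (∀ u v → (Edge μ u v → Adj G u v) × (Adj G u v → Edge μ u v))

  Nice : Expr n k → Set
  Nice (intro _ _) = ⊤
  Nice (a ⊕ b)     = Nice a × Nice b
  Nice (ρ i j t)   = Nice t × Labels t i × Labels t j
  Nice (η i j t)   = Nice t
                   × (∀ u v → Lab t u i → Lab t v j → ¬ Edge t u v)
                   × (∃[ u ] ∃[ v ] (Edge (η i j t) u v × ¬ Edge t u v))
                   × Labels t i × Labels t j

  InD : Graph n → Expr n k → Fin n → Set
  InD G t v = InV t v × (∀ u → Adj G v u → Edge t v u)

  -- For the join node  η i j t' , the condition  V_t^ℓ ⊆ D_t ∖ D_{t'}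
  -- under which a node dead_ℓ is inserted above it in the augmented tree.
  DeadCond : Graph n → Fin k → Fin k → Expr n k → Fin k → Set
  DeadCond G i j t' ℓ =
    ∀ v → Lab (η i j t') v ℓ → InD G (η i j t') v × ¬ InD G t' v

  -- Live labels of the topmost augmented-tree node corresponding to a node
  -- of μ (i.e. a join node together with the dead nodes inserted above it).
  Live : Graph n → Expr n k → Fin k → Set
  Live G (intro _ ℓ) m = m ≡ ℓ
  Live G (a ⊕ b)     m = Live G a m ⊎ Live G b m
  Live G (ρ i j t)   m = Live G t m × m ≢ i
  Live G (η i j t)   m = Live G t m
                       × ¬ (m ≡ i × DeadCond G i j t i)
                       × ¬ (m ≡ j × DeadCond G i j t j)

  DeadL : Graph n → Expr n k → Fin k → Set
  DeadL G t m = Labels t m × ¬ Live G t m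

{-# OPTIONS --safe #-}
module Submission where

-- Two vertices sharing a label at a node t of a nice expression acquire the same
-- edges above t, and irredundancy forbids re-adding an edge; so if one of them
-- is dead (in D_t) so is the other, and each label class V_t^ℓ is either
-- entirely dead or has no dead vertex.  Since in a connected graph with at least
-- two vertices nobody is dead at an introduce node, induction over the tree
-- shows that ℓ is live at t exactly when V_t^ℓ is nonempty and not entirely
-- dead.  At a union node a label occurring on both sides forms one class of the
-- union, so it cannot be live on one side and dead on the other.

open import Defs
open import Data.Nat using (ℕ; _≤_; s≤s; z≤n)
open import Data.Fin using (Fin; zero; _≟_; punchIn)
open import Data.Fin.Properties using (any?; all?; punchInᵢ≢i)
open import Data.Product using (_×_; _,_; proj₁; proj₂; map₂; ∃-syntax)
open import Data.Sum using (_⊎_; inj₁; inj₂)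
open import Data.Empty using (⊥; ⊥-elim)
open import Function using (_∘_)
open import Relation.Nullary using (¬_; Dec; yes; no)
open import Relation.Nullary.Decidable using (_×-dec_; _⊎-dec_; _→-dec_; ¬?; decidable-stable)
open import Relation.Binary.PropositionalEquality using (_≡_; _≢_; refl; sym; subst)
open import Relation.Binary.Construct.Closure.ReflexiveTransitive using (Star; ε; _◅_)

Star-step : ∀ {A : Set} {R : A → A → Set} {u v} → Star R u v → u ≢ v → ∃[ w ] R u w
Star-step ε u≢u = ⊥-elim (u≢u refl)
Star-step (r ◅ _) _ = _ , r

connected⇒neighbour : ∀ {n} (G : Graph n) → 2 ≤ n → Connected G → ∀ v → ∃[ u ] Adj G v u
connected⇒neighbour G (s≤s (s≤s z≤n)) conn v =
  Star-step (conn v (punchIn v zero)) (punchInᵢ≢i v zero ∘ sym)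

module _ {n k : ℕ} where

  ≼-trans : ∀ {s t u : Expr n k} → s ≼ t → t ≼ u → s ≼ u
  ≼-trans p here       = p
  ≼-trans p (left q)   = left (≼-trans p q)
  ≼-trans p (right q)  = right (≼-trans p q)
  ≼-trans p (underρ q) = underρ (≼-trans p q)
  ≼-trans p (underη q) = underη (≼-trans p q)

  WF-≼ : ∀ {s t : Expr n k} → s ≼ t → WF t → WF s
  WF-≼ here       w            = w
  WF-≼ (left p)   (wa , _ , _) = WF-≼ p wa
  WF-≼ (right p)  (_ , wb , _) = WF-≼ p wb
  WF-≼ (underρ p) (_ , w)      = WF-≼ p w
  WF-≼ (underη p) (_ , w)      = WF-≼ p w

  Nice-≼ : ∀ {s t : Expr n k} → s ≼ t → Nice t → Nice s
  Nice-≼ here       w        = w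
  Nice-≼ (left p)   (wa , _) = Nice-≼ p wa
  Nice-≼ (right p)  (_ , wb) = Nice-≼ p wb
  Nice-≼ (underρ p) (w , _)  = Nice-≼ p w
  Nice-≼ (underη p) (w , _)  = Nice-≼ p w

  Edge-≼ : ∀ {s t : Expr n k} {u v} → s ≼ t → Edge s u v → Edge t u v
  Edge-≼ here       e = e
  Edge-≼ (left p)   e = inj₁ (Edge-≼ p e)
  Edge-≼ (right p)  e = inj₂ (Edge-≼ p e)
  Edge-≼ (underρ p) e = Edge-≼ p e
  Edge-≼ (underη p) e = inj₁ (Edge-≼ p e)

  sameLabel-≼ : ∀ {s t : Expr n k} {v w ℓ} → s ≼ t → Lab s v ℓ → Lab s w ℓ
              → ∃[ m ] Lab t v m × Lab t w m
  sameLabel-≼ {ℓ = ℓ} here lv lw = ℓ , lv , lw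
  sameLabel-≼ (left p) lv lw with sameLabel-≼ p lv lw
  ... | m , lv′ , lw′ = m , inj₁ lv′ , inj₁ lw′
  sameLabel-≼ (right p) lv lw with sameLabel-≼ p lv lw
  ... | m , lv′ , lw′ = m , inj₂ lv′ , inj₂ lw′
  sameLabel-≼ (underρ {i = i} {j} p) lv lw with sameLabel-≼ p lv lw
  ... | m , lv′ , lw′ with m ≟ i
  ... | yes refl = j , inj₂ (lv′ , refl) , inj₂ (lw′ , refl)
  ... | no m≢i   = m , inj₁ (lv′ , m≢i) , inj₁ (lw′ , m≢i)
  sameLabel-≼ (underη p) lv lw = sameLabel-≼ p lv lw

  InV-≼ : ∀ {s t : Expr n k} {v} → s ≼ t → InV s v → InV t v
  InV-≼ p (_ , lv) with sameLabel-≼ p lv lv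
  ... | m , lv′ , _ = m , lv′

  Lab-unique : ∀ {t : Expr n k} {u m m′} → WF t → Lab t u m → Lab t u m′ → m ≡ m′
  Lab-unique {intro _ _} _ (_ , refl) (_ , refl) = refl
  Lab-unique {a ⊕ b} (wa , _ , _) (inj₁ x) (inj₁ y) = Lab-unique wa x y
  Lab-unique {a ⊕ b} (_ , _ , disj) (inj₁ x) (inj₂ y) = ⊥-elim (disj _ (_ , x) (_ , y))
  Lab-unique {a ⊕ b} (_ , _ , disj) (inj₂ x) (inj₁ y) = ⊥-elim (disj _ (_ , y) (_ , x))
  Lab-unique {a ⊕ b} (_ , wb , _) (inj₂ x) (inj₂ y) = Lab-unique wb x y
  Lab-unique {ρ i j t} (_ , w) (inj₁ (x , _)) (inj₁ (y , _)) = Lab-unique w x y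
  Lab-unique {ρ i j t} (_ , w) (inj₁ (x , m≢i)) (inj₂ (y , _)) = ⊥-elim (m≢i (Lab-unique w x y))
  Lab-unique {ρ i j t} (_ , w) (inj₂ (x , _)) (inj₁ (y , m≢i)) = ⊥-elim (m≢i (Lab-unique w y x))
  Lab-unique {ρ i j t} _ (inj₂ (_ , refl)) (inj₂ (_ , refl)) = refl
  Lab-unique {η i j t} (_ , w) x y = Lab-unique w x y

  Edge⇒InV : ∀ (t : Expr n k) {u v} → Edge t u v → InV t u
  Edge⇒InV (a ⊕ b)   (inj₁ e)                = map₂ inj₁ (Edge⇒InV a e)
  Edge⇒InV (a ⊕ b)   (inj₂ e)                = map₂ inj₂ (Edge⇒InV b e)
  Edge⇒InV (ρ i j t) e                       = InV-≼ {t = ρ i j t} (underρ here) (Edge⇒InV t e)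
  Edge⇒InV (η i j t) (inj₁ e)                = Edge⇒InV t e
  Edge⇒InV (η i j t) (inj₂ (inj₁ (lu , _))) = i , lu
  Edge⇒InV (η i j t) (inj₂ (inj₂ (lu , _))) = j , lu

  Edge-sym : ∀ (t : Expr n k) {u v} → Edge t u v → Edge t v u
  Edge-sym (a ⊕ b)   (inj₁ e)                 = inj₁ (Edge-sym a e)
  Edge-sym (a ⊕ b)   (inj₂ e)                 = inj₂ (Edge-sym b e)
  Edge-sym (ρ i j t) e                        = Edge-sym t e
  Edge-sym (η i j t) (inj₁ e)                 = inj₁ (Edge-sym t e)
  Edge-sym (η i j t) (inj₂ (inj₁ (lu , lv))) = inj₂ (inj₂ (lv , lu))
  Edge-sym (η i j t) (inj₂ (inj₂ (lu , lv))) = inj₂ (inj₁ (lv , lu))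

  Edge-⊕⁻ˡ : ∀ (a b : Expr n k) {w u} → WF (a ⊕ b) → InV a w → Edge (a ⊕ b) w u → Edge a w u
  Edge-⊕⁻ˡ _ _ _ _ (inj₁ e) = e
  Edge-⊕⁻ˡ _ b (_ , _ , disj) iw (inj₂ e) = ⊥-elim (disj _ iw (Edge⇒InV b e))

  Edge-⊕⁻ʳ : ∀ (a b : Expr n k) {w u} → WF (a ⊕ b) → InV b w → Edge (a ⊕ b) w u → Edge b w u
  Edge-⊕⁻ʳ a _ (_ , _ , disj) iw (inj₁ e) = ⊥-elim (disj _ (Edge⇒InV a e) iw)
  Edge-⊕⁻ʳ _ _ _ _ (inj₂ e) = e

  Edge-η⁻ : ∀ {i j} {t : Expr n k} {w u ℓ} → WF t → Lab t w ℓ → ℓ ≢ i → ℓ ≢ j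
          → Edge (η i j t) w u → Edge t w u
  Edge-η⁻ _ _ _ _ (inj₁ e) = e
  Edge-η⁻ wf lw ℓ≢i _ (inj₂ (inj₁ (lwᵢ , _))) = ⊥-elim (ℓ≢i (Lab-unique wf lw lwᵢ))
  Edge-η⁻ wf lw _ ℓ≢j (inj₂ (inj₂ (lwⱼ , _))) = ⊥-elim (ℓ≢j (Lab-unique wf lw lwⱼ))

  Settled : Expr n k → Expr n k → Fin n → Set
  Settled s t v = ∀ x → Edge t v x → Edge s v x

  -- v and w keep a common label at every ancestor of s.  An edge wx added by a
  -- join η_{i,j} above s therefore comes with the edge vx, which is then
  -- already present below that join, against irredundancy.
  Settled-sameLabel : ∀ {s t : Expr n k} {v w ℓ} → s ≼ t → WF t → Nice t
                    → Lab s v ℓ → Lab s w ℓ → Settled s t v → Settled s t w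
  Settled-sameLabel here _ _ _ _ _ x e = e
  Settled-sameLabel {t = a ⊕ b} (left p) wf@(wa , _) (na , _) lv lw sv x e =
    Settled-sameLabel p wa na lv lw (λ y → sv y ∘ inj₁) x (Edge-⊕⁻ˡ a b wf (InV-≼ p (_ , lw)) e)
  Settled-sameLabel {t = a ⊕ b} (right p) wf@(_ , wb , _) (_ , nb) lv lw sv x e =
    Settled-sameLabel p wb nb lv lw (λ y → sv y ∘ inj₂) x (Edge-⊕⁻ʳ a b wf (InV-≼ p (_ , lw)) e)
  Settled-sameLabel (underρ p) (_ , wt) (nt , _) lv lw sv x e =
    Settled-sameLabel p wt nt lv lw sv x e
  Settled-sameLabel (underη p) (_ , wt) (nt , _) lv lw sv x (inj₁ e) =
    Settled-sameLabel p wt nt lv lw (λ y → sv y ∘ inj₁) x e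
  Settled-sameLabel (underη p) (_ , wt) (_ , irred , _) lv lw sv x (inj₂ (inj₁ (lwᵢ , lxⱼ)))
    with sameLabel-≼ p lv lw
  ... | m , lv′ , lw′ with Lab-unique wt lw′ lwᵢ
  ... | refl = ⊥-elim (irred _ x lv′ lxⱼ (Edge-≼ p (sv x (inj₂ (inj₁ (lv′ , lxⱼ))))))
  Settled-sameLabel {t = η _ _ t} (underη p) (_ , wt) (_ , irred , _) lv lw sv x (inj₂ (inj₂ (lwⱼ , lxᵢ)))
    with sameLabel-≼ p lv lw
  ... | m , lv′ , lw′ with Lab-unique wt lw′ lwⱼ
  ... | refl = ⊥-elim (irred x _ lxᵢ lv′ (Edge-sym t (Edge-≼ p (sv x (inj₂ (inj₂ (lv′ , lxᵢ)))))))

  Lab? : ∀ (t : Expr n k) u m → Dec (Lab t u m)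
  Lab? (intro v ℓ) u m = (u ≟ v) ×-dec (m ≟ ℓ)
  Lab? (a ⊕ b)     u m = Lab? a u m ⊎-dec Lab? b u m
  Lab? (ρ i j t)   u m = (Lab? t u m ×-dec ¬? (m ≟ i)) ⊎-dec (Lab? t u i ×-dec (m ≟ j))
  Lab? (η i j t)   u m = Lab? t u m

  Edge? : ∀ (t : Expr n k) u v → Dec (Edge t u v)
  Edge? (intro _ _) u v = no λ ()
  Edge? (a ⊕ b)     u v = Edge? a u v ⊎-dec Edge? b u v
  Edge? (ρ _ _ t)   u v = Edge? t u v
  Edge? (η i j t)   u v = Edge? t u v ⊎-dec
    ((Lab? t u i ×-dec Lab? t v j) ⊎-dec (Lab? t u j ×-dec Lab? t v i))

  Labels? : ∀ (t : Expr n k) ℓ → Dec (Labels t ℓ)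
  Labels? t ℓ = any? λ v → Lab? t v ℓ

  Live⇒Labels : ∀ {G : Graph n} (t : Expr n k) {ℓ} → Live G t ℓ → Labels t ℓ
  Live⇒Labels (intro v ℓ) refl = v , refl , refl
  Live⇒Labels (a ⊕ b) (inj₁ l) with Live⇒Labels a l
  ... | v , lv = v , inj₁ lv
  Live⇒Labels (a ⊕ b) (inj₂ l) with Live⇒Labels b l
  ... | v , lv = v , inj₂ lv
  Live⇒Labels (ρ i j t) (l , ℓ≢i) with Live⇒Labels t l
  ... | v , lv = v , inj₁ (lv , ℓ≢i)
  Live⇒Labels (η i j t) (l , _) = Live⇒Labels t l

  module DeadVertices (G : Graph n) where

    AllDead : Expr n k → Fin k → Set
    AllDead t ℓ = ∀ v → Lab t v ℓ → InD G t v

    InD-⊕⁺ˡ : ∀ (a b : Expr n k) {v} → InD G a v → InD G (a ⊕ b) v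
    InD-⊕⁺ˡ _ _ ((m , lv) , settled) = (m , inj₁ lv) , λ u → inj₁ ∘ settled u

    InD-⊕⁺ʳ : ∀ (a b : Expr n k) {v} → InD G b v → InD G (a ⊕ b) v
    InD-⊕⁺ʳ _ _ ((m , lv) , settled) = (m , inj₂ lv) , λ u → inj₂ ∘ settled u

    AllDead-⊕⁻ˡ : ∀ (a b : Expr n k) {ℓ} → WF (a ⊕ b) → AllDead (a ⊕ b) ℓ → AllDead a ℓ
    AllDead-⊕⁻ˡ a b wf dead v lv = (_ , lv) , λ u → Edge-⊕⁻ˡ a b wf (_ , lv) ∘ proj₂ (dead v (inj₁ lv)) u

    AllDead-⊕⁻ʳ : ∀ (a b : Expr n k) {ℓ} → WF (a ⊕ b) → AllDead (a ⊕ b) ℓ → AllDead b ℓ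
    AllDead-⊕⁻ʳ a b wf dead v lv = (_ , lv) , λ u → Edge-⊕⁻ʳ a b wf (_ , lv) ∘ proj₂ (dead v (inj₂ lv)) u

  Parts : Graph n → Expr n k → Expr n k → Fin k → Set
  Parts G a b ℓ = (Live G a ℓ × ¬ Labels b ℓ)
                ⊎ ((Live G b ℓ × ¬ Labels a ℓ) ⊎ (Live G a ℓ × Live G b ℓ))

  Parts⇒Live-⊕ : ∀ {G} {a b : Expr n k} {ℓ} → Parts G a b ℓ → Live G (a ⊕ b) ℓ
  Parts⇒Live-⊕ (inj₁ (la , _))        = inj₁ la
  Parts⇒Live-⊕ (inj₂ (inj₁ (lb , _))) = inj₂ lb
  Parts⇒Live-⊕ (inj₂ (inj₂ (la , _))) = inj₁ la

  module KExpr (G : Graph n) (μ : Expr n k) (wfμ : WF μ) (niceμ : Nice μ)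
               (edgesμ : ∀ u v → (Edge μ u v → Adj G u v) × (Adj G u v → Edge μ u v))
               (neighbour : ∀ v → ∃[ u ] Adj G v u) where

    open DeadVertices G

    Adj? : ∀ u v → Dec (Adj G u v)
    Adj? u v with Edge? μ u v
    ... | yes e  = yes (proj₁ (edgesμ u v) e)
    ... | no ¬e = no (¬e ∘ proj₂ (edgesμ u v))

    InD? : ∀ t v → Dec (InD G t v)
    InD? t v = any? (Lab? t v) ×-dec all? λ u → Adj? v u →-dec Edge? t v u

    DeadCond? : ∀ i j t ℓ → Dec (DeadCond G i j t ℓ)
    DeadCond? i j t ℓ = all? λ v → Lab? (η i j t) v ℓ →-dec (InD? (η i j t) v ×-dec ¬? (InD? t v))

    Live? : ∀ t ℓ → Dec (Live G t ℓ)
    Live? (intro _ ℓ′) ℓ = ℓ ≟ ℓ′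
    Live? (a ⊕ b)     ℓ = Live? a ℓ ⊎-dec Live? b ℓ
    Live? (ρ i j t)   ℓ = Live? t ℓ ×-dec ¬? (ℓ ≟ i)
    Live? (η i j t)   ℓ = Live? t ℓ ×-dec ¬? ((ℓ ≟ i) ×-dec DeadCond? i j t i)
                                    ×-dec ¬? ((ℓ ≟ j) ×-dec DeadCond? i j t j)

    InD⇒AllDead : ∀ {s v ℓ} → s ≼ μ → Lab s v ℓ → InD G s v → AllDead s ℓ
    InD⇒AllDead s≼μ lv (_ , settledᵥ) w lw =
      (_ , lw) , λ x adj →
        Settled-sameLabel s≼μ wfμ niceμ lv lw (λ y → settledᵥ y ∘ proj₁ (edgesμ _ y)) x (proj₂ (edgesμ w x) adj)

    Live⇒¬AllDead : ∀ t {ℓ} → t ≼ μ → Live G t ℓ → ¬ AllDead t ℓ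
    Live⇒¬AllDead (intro v _) _ refl dead with neighbour v
    ... | u , adj = proj₂ (dead v (refl , refl)) u adj
    Live⇒¬AllDead (a ⊕ b) ab≼μ (inj₁ la) dead =
      Live⇒¬AllDead a (≼-trans (left here) ab≼μ) la (AllDead-⊕⁻ˡ a b (WF-≼ ab≼μ wfμ) dead)
    Live⇒¬AllDead (a ⊕ b) ab≼μ (inj₂ lb) dead =
      Live⇒¬AllDead b (≼-trans (right here) ab≼μ) lb (AllDead-⊕⁻ʳ a b (WF-≼ ab≼μ wfμ) dead)
    Live⇒¬AllDead (ρ i j t) ρ≼μ (l , ℓ≢i) dead =
      Live⇒¬AllDead t (≼-trans (underρ here) ρ≼μ) l λ w lw → (_ , lw) , proj₂ (dead w (inj₁ (lw , ℓ≢i)))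
    Live⇒¬AllDead (η i j t) {ℓ} η≼μ (l , ¬deadᵢ , ¬deadⱼ) dead = byLabel (ℓ ≟ i) (ℓ ≟ j)
      where
      t≼μ : t ≼ μ
      t≼μ = ≼-trans (underη here) η≼μ
      ¬deadₜ : ¬ AllDead t ℓ
      ¬deadₜ = Live⇒¬AllDead t t≼μ l
      -- No vertex of label ℓ lies in D_t, since one would make the whole class dead.
      deadCond : DeadCond G i j t ℓ
      deadCond v lv = dead v lv , ¬deadₜ ∘ InD⇒AllDead t≼μ lv
      byLabel : Dec (ℓ ≡ i) → Dec (ℓ ≡ j) → ⊥
      byLabel (yes ℓ≡i) _         = ¬deadᵢ (ℓ≡i , subst (DeadCond G i j t) ℓ≡i deadCond)
      byLabel (no _)    (yes ℓ≡j) = ¬deadⱼ (ℓ≡j , subst (DeadCond G i j t) ℓ≡j deadCond)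
      byLabel (no ℓ≢i)  (no ℓ≢j)  = ¬deadₜ λ w lw →
        (_ , lw) , λ u → Edge-η⁻ (proj₂ (WF-≼ η≼μ wfμ)) lw ℓ≢i ℓ≢j ∘ proj₂ (dead w lw) u

    ¬Live⇒AllDead : ∀ t {ℓ} → t ≼ μ → ¬ Live G t ℓ → AllDead t ℓ
    ¬Live⇒AllDead (intro _ _) _ ¬l _ (_ , ℓ≡) = ⊥-elim (¬l ℓ≡)
    ¬Live⇒AllDead (a ⊕ b) ab≼μ ¬l v (inj₁ lv) =
      InD-⊕⁺ˡ a b (¬Live⇒AllDead a (≼-trans (left here) ab≼μ) (¬l ∘ inj₁) v lv)
    ¬Live⇒AllDead (a ⊕ b) ab≼μ ¬l v (inj₂ lv) =
      InD-⊕⁺ʳ a b (¬Live⇒AllDead b (≼-trans (right here) ab≼μ) (¬l ∘ inj₂) v lv)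
    ¬Live⇒AllDead (ρ i j t) ρ≼μ ¬l v (inj₁ (lv , ℓ≢i)) =
      (_ , inj₁ (lv , ℓ≢i)) , proj₂ (¬Live⇒AllDead t (≼-trans (underρ here) ρ≼μ) (¬l ∘ (_, ℓ≢i)) v lv)
    ¬Live⇒AllDead (ρ i j t) ρ≼μ ¬l v (inj₂ (lv , refl)) = byLiveness (Live? t i)
      where
      t≼μ : t ≼ μ
      t≼μ = ≼-trans (underρ here) ρ≼μ
      j≢i : j ≢ i
      j≢i = proj₁ (WF-≼ ρ≼μ wfμ) ∘ sym
      -- Niceness supplies a vertex u of label j in t; j is not live in t, so u is
      -- dead, and after the relabelling u shares its label with the old class i.
      deadⱼ : AllDead (ρ i j t) j
      deadⱼ with proj₂ (proj₂ (Nice-≼ ρ≼μ niceμ))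
      ... | u , luⱼ = InD⇒AllDead ρ≼μ (inj₁ (luⱼ , j≢i))
        ((_ , inj₁ (luⱼ , j≢i)) , proj₂ (¬Live⇒AllDead t t≼μ (¬l ∘ (_, j≢i)) u luⱼ))
      byLiveness : Dec (Live G t i) → InD G (ρ i j t) v
      byLiveness (no ¬lᵢ) = (_ , inj₂ (lv , refl)) , proj₂ (¬Live⇒AllDead t t≼μ ¬lᵢ v lv)
      byLiveness (yes lᵢ) = ⊥-elim (Live⇒¬AllDead t t≼μ lᵢ λ w lw →
        (_ , lw) , proj₂ (deadⱼ w (inj₂ (lw , refl))))
    ¬Live⇒AllDead (η i j t) {ℓ} η≼μ ¬l v lv = byLiveness (Live? t ℓ)
      where
      byDeadCond : Dec (ℓ ≡ i × DeadCond G i j t i) → Dec (ℓ ≡ j × DeadCond G i j t j)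
                 → Live G t ℓ → InD G (η i j t) v
      byDeadCond (yes (ℓ≡i , dc)) _ _ = proj₁ (dc v (subst (Lab t v) ℓ≡i lv))
      byDeadCond (no _) (yes (ℓ≡j , dc)) _ = proj₁ (dc v (subst (Lab t v) ℓ≡j lv))
      byDeadCond (no ¬dᵢ) (no ¬dⱼ) lₜ = ⊥-elim (¬l (lₜ , ¬dᵢ , ¬dⱼ))
      byLiveness : Dec (Live G t ℓ) → InD G (η i j t) v
      byLiveness (no ¬lₜ) with ¬Live⇒AllDead t (≼-trans (underη here) η≼μ) ¬lₜ v lv
      ... | iv , settled = iv , λ u → inj₁ ∘ settled u
      byLiveness (yes lₜ) =
        byDeadCond ((ℓ ≟ i) ×-dec DeadCond? i j t i) ((ℓ ≟ j) ×-dec DeadCond? i j t j) lₜ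

    -- A dead vertex of label ℓ in b is dead in a ⊕ b, which kills the whole
    -- ℓ-class of a ⊕ b and with it that of a.
    Live-Dead-disjointˡ : ∀ {a b ℓ} → (a ⊕ b) ≼ μ → ¬ (Live G a ℓ × DeadL G b ℓ)
    Live-Dead-disjointˡ {a} {b} ab≼μ (la , (v , lv) , ¬lb) =
      Live⇒¬AllDead a (≼-trans (left here) ab≼μ) la
        (AllDead-⊕⁻ˡ a b (WF-≼ ab≼μ wfμ)
          (InD⇒AllDead ab≼μ (inj₂ lv) (InD-⊕⁺ʳ a b (¬Live⇒AllDead b (≼-trans (right here) ab≼μ) ¬lb v lv))))

    Live-Dead-disjointʳ : ∀ {a b ℓ} → (a ⊕ b) ≼ μ → ¬ (DeadL G a ℓ × Live G b ℓ)
    Live-Dead-disjointʳ {a} {b} ab≼μ (((v , lv) , ¬la) , lb) =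
      Live⇒¬AllDead b (≼-trans (right here) ab≼μ) lb
        (AllDead-⊕⁻ʳ a b (WF-≼ ab≼μ wfμ)
          (InD⇒AllDead ab≼μ (inj₁ lv) (InD-⊕⁺ˡ a b (¬Live⇒AllDead a (≼-trans (left here) ab≼μ) ¬la v lv))))

    Live-⊕⇒Parts : ∀ {a b ℓ} → (a ⊕ b) ≼ μ → Live G (a ⊕ b) ℓ → Parts G a b ℓ
    Live-⊕⇒Parts {a} {b} {ℓ} ab≼μ (inj₁ la) with Labels? b ℓ
    ... | no ¬labᵦ = inj₁ (la , ¬labᵦ)
    ... | yes labᵦ = inj₂ (inj₂ (la , decidable-stable (Live? b ℓ) λ ¬lb →
                       Live-Dead-disjointˡ ab≼μ (la , labᵦ , ¬lb)))
    Live-⊕⇒Parts {a} {b} {ℓ} ab≼μ (inj₂ lb) with Labels? a ℓ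
    ... | no ¬labₐ = inj₂ (inj₁ (lb , ¬labₐ))
    ... | yes labₐ = inj₂ (inj₂ (decidable-stable (Live? a ℓ) (λ ¬la →
                       Live-Dead-disjointʳ ab≼μ ((labₐ , ¬la) , lb)) , lb))

lemma20 : ∀ {n k : ℕ} (G : Graph n) → 2 ≤ n → Connected G
          → (μ : Expr n k) → IsKExpr G μ → Nice μ
          → ∀ t₁ t₂ → (t₁ ⊕ t₂) ≼ μ
          → (∀ ℓ → ¬ (Live G t₁ ℓ × DeadL G t₂ ℓ))
          × (∀ ℓ → ¬ (DeadL G t₁ ℓ × Live G t₂ ℓ))
          × (∀ ℓ → (Live G (t₁ ⊕ t₂) ℓ
                     → (Live G t₁ ℓ × ¬ Labels t₂ ℓ)
                       ⊎ ((Live G t₂ ℓ × ¬ Labels t₁ ℓ)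
                       ⊎ (Live G t₁ ℓ × Live G t₂ ℓ)))
                 × ((Live G t₁ ℓ × ¬ Labels t₂ ℓ)
                       ⊎ ((Live G t₂ ℓ × ¬ Labels t₁ ℓ)
                       ⊎ (Live G t₁ ℓ × Live G t₂ ℓ))
                     → Live G (t₁ ⊕ t₂) ℓ))
          × (∀ ℓ → ¬ ((Live G t₁ ℓ × ¬ Labels t₂ ℓ) × (Live G t₂ ℓ × ¬ Labels t₁ ℓ)))
          × (∀ ℓ → ¬ ((Live G t₁ ℓ × ¬ Labels t₂ ℓ) × (Live G t₁ ℓ × Live G t₂ ℓ)))
          × (∀ ℓ → ¬ ((Live G t₂ ℓ × ¬ Labels t₁ ℓ) × (Live G t₁ ℓ × Live G t₂ ℓ)))
lemma20 G 2≤n conn μ (wfμ , _ , edgesμ) niceμ t₁ t₂ t≼μ =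
    (λ _ → Live-Dead-disjointˡ t≼μ)
  , (λ _ → Live-Dead-disjointʳ t≼μ)
  , (λ _ → Live-⊕⇒Parts t≼μ , Parts⇒Live-⊕)
  , (λ _ ((_ , ¬lab₂) , (l₂ , _)) → ¬lab₂ (Live⇒Labels t₂ l₂))
  , (λ _ ((_ , ¬lab₂) , (_ , l₂)) → ¬lab₂ (Live⇒Labels t₂ l₂))
  , (λ _ ((_ , ¬lab₁) , (l₁ , _)) → ¬lab₁ (Live⇒Labels t₁ l₁))
  where open KExpr G μ wfμ niceμ edgesμ (connected⇒neighbour G 2≤n conn)
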